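{- $\chi_2(7)=5$.
   Context: $\chi_2(n)$ denotes the minimum number of colors needed to color the nonzero vectors of $\mathbb{F}_2^n$ (the points of $\mathrm{PG}(n-1,2)$) so that no triple $\{x,y,x+y\}$ with $x\ne y$ nonzero (a line of $\mathrm{PG}(n-1,2)$) is monochromatic. -}

module Defs where

open import Data.Bool using (Bool; false; _xor_)
open import Data.Nat using (ℕ; _≤_)
open import Data.Fin using (Fin)
open import Data.Vec using (Vec; replicate; zipWith)
open import Data.Product using (_×_; Σ)
open import Relation.Binary.PropositionalEquality using (_≡_; _≢_)
open import Relation.Nullary using (¬_)

F₂^ : ℕ → Set
F₂^ n = Vec Bool n

𝟎 : ∀ {n} → F₂^ n
𝟎 {n} = replicate n false

_⊕_ : ∀ {n} → F₂^ n → F₂^ n → F₂^ n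
_⊕_ = zipWith _xor_

NonZero : ∀ {n} → F₂^ n → Set
NonZero x = x ≢ 𝟎

-- a colouring of the nonzero vectors of F₂ⁿ (points of PG(n-1,2)) with k colours
Colouring : ℕ → ℕ → Set
Colouring n k = (x : F₂^ n) → NonZero x → Fin k

Proper : ∀ {n k} → Colouring n k → Set
Proper {n} c = (x y : F₂^ n) (hx : NonZero x) (hy : NonZero y) (hxy : NonZero (x ⊕ y)) →
  x ≢ y → ¬ (c x hx ≡ c y hy × c y hy ≡ c (x ⊕ y) hxy)

Colourable : ℕ → ℕ → Set
Colourable n k = Σ (Colouring n k) Proper

χ₂≡ : ℕ → ℕ → Set
χ₂≡ n k = Colourable n k × (∀ m → Colourable n m → k ≤ m)

{-# OPTIONS --safe #-}
module Submission where

-- A proper k-colouring c of the points of PG(n-1,2) colours each edge {u, w} of the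
-- complete graph on F₂ⁿ with c(u + w).  As u + v, u + w, v + w always form a line,
-- no triangle is monochromatic, so the classical bound R(3; k) ≤ ramseyBound k + 1 for
-- multicolour Ramsey numbers gives 2ⁿ ≤ ramseyBound k.  Since ramseyBound 4 = 65 < 2⁷,
-- four colours cannot colour PG(6,2); five can, by an explicit colouring checked by
-- exhaustive computation.

open import Defs
open import Data.Bool using (Bool; true; false; _xor_)
import Data.Bool as Bool
open import Data.Bool.Properties using (not-involutive)
open import Data.Fin using (Fin; zero; suc; combine; #_)
import Data.Fin.Properties as Fin
open import Data.List using (List; []; _∷_; _++_; map; length; filter; allFin)
open import Data.List.Membership.Propositional using (_∈_)
open import Data.List.Membership.Propositional.Properties
  using (∈-filter⁺; ∈-filter⁻; ∈-map⁺; ∈-map⁻; ∈-++⁺ˡ; ∈-++⁺ʳ; ∈-allFin)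
open import Data.List.Properties using (filter-notAll; length-++; length-map; length-tabulate)
open import Data.List.Relation.Binary.Disjoint.Propositional using (Disjoint)
open import Data.List.Relation.Binary.Sublist.Propositional.Properties
  using (filter-⊆; filter⁺; length-mono-≤)
import Data.List.Relation.Unary.All as All
import Data.List.Relation.Unary.Any as Any
open import Data.List.Relation.Unary.Any using (here; there)
open import Data.List.Relation.Unary.AllPairs using ([]; _∷_)
open import Data.List.Relation.Unary.Unique.Propositional using (Unique)
import Data.List.Relation.Unary.Unique.Propositional.Properties as Unique
open import Data.Maybe using (Maybe; just; nothing)
import Data.Maybe.Properties as Maybe
open import Data.Nat using (ℕ; zero; suc; _+_; _*_; _^_; _≤_; _≤?_; z≤n; s≤s)
open import Data.Nat.Properties
  using (≤-refl; ≤-trans; ≤-pred; ≤-reflexive; ≮⇒≥; +-mono-≤; +-suc; +-identityʳ; *-mono-≤; *-monoˡ-≤;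
         module ≤-Reasoning)
open import Data.Product using (_×_; _,_; proj₁; proj₂; ∃-syntax)
open import Data.Vec using (Vec; []; _∷_; lookup)
open import Data.Vec.Properties using (≡-dec; ∷-injective)
open import Data.Empty using (⊥)
open import Function using (_∘_)
open import Level using (Level)
open import Relation.Binary.Definitions using (DecidableEquality)
open import Relation.Binary.PropositionalEquality
  using (_≡_; _≢_; refl; sym; trans; cong; cong₂; subst; module ≡-Reasoning)
open import Relation.Nullary using (Dec; ¬_; yes; no; does; ¬?; _×-dec_; map′; contradiction; from-yes; from-no)
open import Relation.Unary using (Pred; Decidable)

module _ {a p : Level} {X : Set a} {P : Pred X p} (P? : Decidable P) where

  length-filter+filter-∁ : ∀ xs → length (filter P? xs) + length (filter (¬? ∘ P?) xs) ≡ length xs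
  length-filter+filter-∁ []       = refl
  length-filter+filter-∁ (x ∷ xs) with does (P? x)
  ... | true  = cong suc (length-filter+filter-∁ xs)
  ... | false = trans (+-suc _ _) (cong suc (length-filter+filter-∁ xs))

module _ {X B : Set} (_≟_ : DecidableEquality B) (f : X → B) where

  fibre : B → List X → List X
  fibre b = filter (λ x → f x ≟ b)

  pigeonhole : ∀ {m} bs xs → (∀ {x} → x ∈ xs → f x ∈ bs) →
               (∀ {b} → b ∈ bs → length (fibre b xs) ≤ m) → length xs ≤ length bs * m
  pigeonhole []       []      _  _ = z≤n
  pigeonhole []       (_ ∷ _) f∈ _ with () ← f∈ (here refl)
  pigeonhole {m} (b ∷ bs) xs f∈ small = begin
    length xs                         ≡⟨ sym (length-filter+filter-∁ (λ x → f x ≟ b) xs) ⟩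
    length (fibre b xs) + length rest ≤⟨ +-mono-≤ (small (here refl)) (pigeonhole bs rest f∈rest small-rest) ⟩
    m + length bs * m                 ∎
    where
    open ≤-Reasoning
    rest : List X
    rest = filter (λ x → ¬? (f x ≟ b)) xs
    f∈rest : ∀ {x} → x ∈ rest → f x ∈ bs
    f∈rest x∈rest with x∈xs , fx≢b ← ∈-filter⁻ _ x∈rest with f∈ x∈xs
    ... | here fx≡b   = contradiction fx≡b fx≢b
    ... | there fx∈bs = fx∈bs
    small-rest : ∀ {b′} → b′ ∈ bs → length (fibre b′ rest) ≤ m
    small-rest b′∈bs =
      ≤-trans (length-mono-≤ (filter⁺ _ _ (λ { refl p → p }) (filter-⊆ _ xs))) (small (there b′∈bs))

ramseyBound : ℕ → ℕ
ramseyBound zero    = 1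
ramseyBound (suc j) = suc (suc j * ramseyBound j)

ramseyBound-mono : ∀ {i j} → i ≤ j → ramseyBound i ≤ ramseyBound j
ramseyBound-mono {j = zero}  z≤n       = ≤-refl
ramseyBound-mono {j = suc _} z≤n       = s≤s z≤n
ramseyBound-mono             (s≤s i≤j) = s≤s (*-mono-≤ (s≤s i≤j) (ramseyBound-mono i≤j))

module _ {V C : Set} (colour : V → V → C) where

  TriangleFree : Set
  TriangleFree = ∀ {u v w} → u ≢ v → u ≢ w → v ≢ w →
                 colour u v ≡ colour u w → colour u w ≡ colour v w → ⊥

  EdgeColoursIn : List C → List V → Set
  EdgeColoursIn A S = ∀ {u w} → u ∈ S → w ∈ S → u ≢ w → colour u w ∈ A

  -- The neighbours joined to a vertex v in colour a span no edge of colour a, so each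
  -- such fibre is a configuration with one colour fewer.
  triangleFree⇒length≤ramseyBound : DecidableEquality C → TriangleFree → ∀ j A S → length A ≤ j →
                                    Unique S → EdgeColoursIn A S → length S ≤ ramseyBound j
  triangleFree⇒length≤ramseyBound _ _ zero [] []          _ _ _ = z≤n
  triangleFree⇒length≤ramseyBound _ _ zero [] (_ ∷ [])    _ _ _ = s≤s z≤n
  triangleFree⇒length≤ramseyBound _ _ zero [] (_ ∷ _ ∷ _) _ ((u≢w All.∷ _) ∷ _) edges
    with () ← edges (here refl) (there (here refl)) u≢w
  triangleFree⇒length≤ramseyBound _ _ (suc j) _ [] _ _ _ = z≤n
  triangleFree⇒length≤ramseyBound _≟_ tf (suc j) A (v ∷ S) |A|≤1+j (v∉S ∷ unique) edges = s≤s (begin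
    length S                 ≤⟨ pigeonhole _≟_ (colour v) A S neighbour∈A fibre≤ramseyBound ⟩
    length A * ramseyBound j ≤⟨ *-monoˡ-≤ (ramseyBound j) |A|≤1+j ⟩
    suc j * ramseyBound j    ∎)
    where
    open ≤-Reasoning
    neighbour∈A : ∀ {u} → u ∈ S → colour v u ∈ A
    neighbour∈A u∈S = edges (here refl) (there u∈S) (All.lookup v∉S u∈S)
    fibre≤ramseyBound : ∀ {a} → a ∈ A → length (fibre _≟_ (colour v) a S) ≤ ramseyBound j
    fibre≤ramseyBound {a} a∈A =
      triangleFree⇒length≤ramseyBound _≟_ tf j others (fibre _≟_ (colour v) a S) |others|≤j
        (Unique.filter⁺ _ unique) fibreEdges
      where
      others : List C
      others = filter (λ b → ¬? (b ≟ a)) A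
      |others|≤j : length others ≤ j
      |others|≤j = ≤-pred (≤-trans (filter-notAll _ A (Any.map (λ a≡b b≢a → b≢a (sym a≡b)) a∈A)) |A|≤1+j)
      fibreEdges : EdgeColoursIn others (fibre _≟_ (colour v) a S)
      fibreEdges u∈F w∈F u≢w with u∈S , vu≡a ← ∈-filter⁻ _ u∈F | w∈S , vw≡a ← ∈-filter⁻ _ w∈F =
        ∈-filter⁺ _ (edges (there u∈S) (there w∈S) u≢w) λ uw≡a →
          tf (All.lookup v∉S u∈S) (All.lookup v∉S w∈S) u≢w (trans vu≡a (sym vw≡a)) (trans vw≡a (sym uw≡a))

nonZero? : ∀ {n} (x : F₂^ n) → Dec (NonZero x)
nonZero? x = ¬? (≡-dec Bool._≟_ x 𝟎)

⊕-same : ∀ {n} (u : F₂^ n) → u ⊕ u ≡ 𝟎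
⊕-same []          = refl
⊕-same (false ∷ u) = cong (false ∷_) (⊕-same u)
⊕-same (true ∷ u)  = cong (false ∷_) (⊕-same u)

≢⇒⊕-nonZero : ∀ {n} {u w : F₂^ n} → u ≢ w → NonZero (u ⊕ w)
≢⇒⊕-nonZero {u = []}        {[]}        u≢w _  = u≢w refl
≢⇒⊕-nonZero {u = false ∷ u} {false ∷ w} u≢w eq = ≢⇒⊕-nonZero (u≢w ∘ cong (false ∷_)) (proj₂ (∷-injective eq))
≢⇒⊕-nonZero {u = true ∷ u}  {true ∷ w}  u≢w eq = ≢⇒⊕-nonZero (u≢w ∘ cong (true ∷_)) (proj₂ (∷-injective eq))
≢⇒⊕-nonZero {u = false ∷ u} {true ∷ w}  _   ()
≢⇒⊕-nonZero {u = true ∷ u}  {false ∷ w} _   ()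

nonZero-⊕⇒≢ : ∀ {n} {u w : F₂^ n} → NonZero (u ⊕ w) → u ≢ w
nonZero-⊕⇒≢ {u = u} u⊕u≢𝟎 refl = u⊕u≢𝟎 (⊕-same u)

[u⊕v]⊕[u⊕w]≡v⊕w : ∀ {n} (u v w : F₂^ n) → (u ⊕ v) ⊕ (u ⊕ w) ≡ v ⊕ w
[u⊕v]⊕[u⊕w]≡v⊕w []          []          []      = refl
[u⊕v]⊕[u⊕w]≡v⊕w (false ∷ u) (b ∷ v)     (c ∷ w) = cong ((b xor c) ∷_) ([u⊕v]⊕[u⊕w]≡v⊕w u v w)
[u⊕v]⊕[u⊕w]≡v⊕w (true ∷ u)  (false ∷ v) (c ∷ w) = cong₂ _∷_ (not-involutive c) ([u⊕v]⊕[u⊕w]≡v⊕w u v w)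
[u⊕v]⊕[u⊕w]≡v⊕w (true ∷ u)  (true ∷ v)  (c ∷ w) = cong (Bool.not c ∷_) ([u⊕v]⊕[u⊕w]≡v⊕w u v w)

allVecs : ∀ n → List (F₂^ n)
allVecs zero    = [] ∷ []
allVecs (suc n) = map (false ∷_) (allVecs n) ++ map (true ∷_) (allVecs n)

∈-allVecs : ∀ {n} (x : F₂^ n) → x ∈ allVecs n
∈-allVecs []          = here refl
∈-allVecs (false ∷ x) = ∈-++⁺ˡ (∈-map⁺ (false ∷_) (∈-allVecs x))
∈-allVecs (true ∷ x)  = ∈-++⁺ʳ _ (∈-map⁺ (true ∷_) (∈-allVecs x))

allVecs-unique : ∀ n → Unique (allVecs n)
allVecs-unique zero    = All.[] ∷ []
allVecs-unique (suc n) = Unique.++⁺ (Unique.map⁺ (proj₂ ∘ ∷-injective) (allVecs-unique n))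
                                    (Unique.map⁺ (proj₂ ∘ ∷-injective) (allVecs-unique n))
                                    heads-differ
  where
  heads-differ : Disjoint (map (false ∷_) (allVecs n)) (map (true ∷_) (allVecs n))
  heads-differ (v∈F , v∈T) with _ , _ , refl ← ∈-map⁻ _ v∈F with _ , _ , () ← ∈-map⁻ _ v∈T

length-allVecs : ∀ n → length (allVecs n) ≡ 2 ^ n
length-allVecs zero    = refl
length-allVecs (suc n) = begin
  length (map (false ∷_) (allVecs n) ++ map (true ∷_) (allVecs n))
    ≡⟨ length-++ (map (false ∷_) (allVecs n)) ⟩
  length (map (false ∷_) (allVecs n)) + length (map (true ∷_) (allVecs n))
    ≡⟨ cong₂ _+_ (length-map _ (allVecs n)) (length-map _ (allVecs n)) ⟩
  length (allVecs n) + length (allVecs n)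
    ≡⟨ cong₂ _+_ (length-allVecs n) (trans (length-allVecs n) (sym (+-identityʳ _))) ⟩
  2 ^ suc n ∎
  where open ≡-Reasoning

module _ {n k} (c : Colouring n k) where

  partialColour : F₂^ n → Maybe (Fin k)
  partialColour x with nonZero? x
  ... | yes x≢𝟎 = just (c x x≢𝟎)
  ... | no  _   = nothing

  -- c may depend on the proof of non-zeroness; partialColour uses the one found by nonZero?.
  partialColour-nonZero : ∀ x → NonZero x → ∃[ x≢𝟎 ] partialColour x ≡ just (c x x≢𝟎)
  partialColour-nonZero x x≢𝟎 with nonZero? x
  ... | yes x≢𝟎′ = x≢𝟎′ , refl
  ... | no  x≡𝟎  = contradiction x≢𝟎 x≡𝟎

  differenceColouring : F₂^ n → F₂^ n → Maybe (Fin k)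
  differenceColouring u w = partialColour (u ⊕ w)

  proper⇒noMonochromaticLine : Proper c → ∀ x y → NonZero x → NonZero y → NonZero (x ⊕ y) →
                               partialColour x ≡ partialColour y → partialColour y ≡ partialColour (x ⊕ y) → ⊥
  proper⇒noMonochromaticLine proper x y x≢𝟎 y≢𝟎 x⊕y≢𝟎 cx≡cy cy≡cx⊕y
    with x≢𝟎′ , cx ← partialColour-nonZero x x≢𝟎
       | y≢𝟎′ , cy ← partialColour-nonZero y y≢𝟎
       | x⊕y≢𝟎′ , cx⊕y ← partialColour-nonZero (x ⊕ y) x⊕y≢𝟎
    = proper x y x≢𝟎′ y≢𝟎′ x⊕y≢𝟎′ (nonZero-⊕⇒≢ x⊕y≢𝟎)
        ( Maybe.just-injective (trans (sym cx) (trans cx≡cy cy))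
        , Maybe.just-injective (trans (sym cy) (trans cy≡cx⊕y cx⊕y)) )

  proper⇒triangleFree : Proper c → TriangleFree differenceColouring
  proper⇒triangleFree proper {u} {v} {w} u≢v u≢w v≢w uv≡uw uw≡vw =
    proper⇒noMonochromaticLine proper (u ⊕ v) (u ⊕ w)
      (≢⇒⊕-nonZero u≢v) (≢⇒⊕-nonZero u≢w) (subst NonZero (sym sum≡v⊕w) (≢⇒⊕-nonZero v≢w))
      uv≡uw (trans uw≡vw (cong partialColour (sym sum≡v⊕w)))
    where
    sum≡v⊕w : (u ⊕ v) ⊕ (u ⊕ w) ≡ v ⊕ w
    sum≡v⊕w = [u⊕v]⊕[u⊕w]≡v⊕w u v w

colourable⇒2^n≤ramseyBound : ∀ {n k} → Colourable n k → 2 ^ n ≤ ramseyBound k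
colourable⇒2^n≤ramseyBound {n} {k} (c , proper) = begin
  2 ^ n              ≡⟨ sym (length-allVecs n) ⟩
  length (allVecs n) ≤⟨ triangleFree⇒length≤ramseyBound (differenceColouring c) (Maybe.≡-dec Fin._≟_)
                          (proper⇒triangleFree c proper) k colours (allVecs n) (≤-reflexive |colours|≡k)
                          (allVecs-unique n) edgeColours ⟩
  ramseyBound k      ∎
  where
  open ≤-Reasoning
  colours : List (Maybe (Fin k))
  colours = map just (allFin k)
  |colours|≡k : length colours ≡ k
  |colours|≡k = trans (length-map just (allFin k)) (length-tabulate _)
  edgeColours : EdgeColoursIn (differenceColouring c) colours (allVecs n)
  edgeColours {u} {w} _ _ u≢w with _ , eq ← partialColour-nonZero c (u ⊕ w) (≢⇒⊕-nonZero u≢w) =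
    subst (_∈ colours) (sym eq) (∈-map⁺ just (∈-allFin _))

∀-F₂^? : ∀ {n} {P : F₂^ n → Set} → Decidable P → Dec (∀ x → P x)
∀-F₂^? {n} P? = map′ (λ all x → All.lookup all (∈-allVecs x)) (λ ∀P → All.tabulate λ {x} _ → ∀P x)
                     (All.all? P? (allVecs n))

module _ {n k} (colour : F₂^ n → Fin k) where

  MonochromaticLine : F₂^ n → F₂^ n → Set
  MonochromaticLine x y =
    NonZero x × NonZero y × NonZero (x ⊕ y) × colour x ≡ colour y × colour y ≡ colour (x ⊕ y)

  monochromaticLine? : ∀ x y → Dec (MonochromaticLine x y)
  monochromaticLine? x y = nonZero? x ×-dec nonZero? y ×-dec nonZero? (x ⊕ y)
                           ×-dec colour x Fin.≟ colour y ×-dec colour y Fin.≟ colour (x ⊕ y)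

  noMonochromaticLine⇒proper : (∀ x y → ¬ MonochromaticLine x y) → Proper (λ x _ → colour x)
  noMonochromaticLine⇒proper lineFree x y x≢𝟎 y≢𝟎 x⊕y≢𝟎 _ (xy , yz) = lineFree x y (x≢𝟎 , y≢𝟎 , x⊕y≢𝟎 , xy , yz)

bit : Bool → Fin 2
bit false = zero
bit true  = suc zero

index : ∀ {n} → F₂^ n → Fin (2 ^ n)
index []      = zero
index (b ∷ x) = combine (bit b) (index x)

-- Entry i colours the vector whose binary expansion, most significant bit first, is i.
palette : Vec (Fin 5) 128
palette =
  # 0 ∷ # 0 ∷ # 4 ∷ # 0 ∷ # 1 ∷ # 0 ∷ # 1 ∷ # 2 ∷ # 4 ∷ # 4 ∷ # 2 ∷ # 0 ∷ # 0 ∷ # 4 ∷ # 4 ∷ # 2 ∷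
  # 4 ∷ # 0 ∷ # 2 ∷ # 4 ∷ # 4 ∷ # 4 ∷ # 0 ∷ # 3 ∷ # 0 ∷ # 3 ∷ # 2 ∷ # 3 ∷ # 0 ∷ # 1 ∷ # 0 ∷ # 4 ∷
  # 0 ∷ # 4 ∷ # 0 ∷ # 3 ∷ # 2 ∷ # 2 ∷ # 0 ∷ # 2 ∷ # 0 ∷ # 2 ∷ # 4 ∷ # 3 ∷ # 3 ∷ # 4 ∷ # 4 ∷ # 0 ∷
  # 4 ∷ # 2 ∷ # 0 ∷ # 4 ∷ # 2 ∷ # 0 ∷ # 4 ∷ # 4 ∷ # 1 ∷ # 3 ∷ # 1 ∷ # 0 ∷ # 4 ∷ # 0 ∷ # 3 ∷ # 0 ∷
  # 2 ∷ # 0 ∷ # 2 ∷ # 2 ∷ # 1 ∷ # 0 ∷ # 4 ∷ # 0 ∷ # 0 ∷ # 4 ∷ # 4 ∷ # 1 ∷ # 4 ∷ # 4 ∷ # 1 ∷ # 0 ∷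
  # 4 ∷ # 4 ∷ # 0 ∷ # 3 ∷ # 1 ∷ # 0 ∷ # 2 ∷ # 4 ∷ # 3 ∷ # 3 ∷ # 0 ∷ # 4 ∷ # 3 ∷ # 3 ∷ # 1 ∷ # 3 ∷
  # 1 ∷ # 2 ∷ # 0 ∷ # 2 ∷ # 0 ∷ # 4 ∷ # 0 ∷ # 1 ∷ # 3 ∷ # 4 ∷ # 4 ∷ # 0 ∷ # 3 ∷ # 2 ∷ # 3 ∷ # 4 ∷
  # 1 ∷ # 0 ∷ # 4 ∷ # 4 ∷ # 4 ∷ # 1 ∷ # 0 ∷ # 4 ∷ # 4 ∷ # 0 ∷ # 2 ∷ # 0 ∷ # 2 ∷ # 3 ∷ # 2 ∷ # 0 ∷ []

fiveColouring : F₂^ 7 → Fin 5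
fiveColouring x = lookup palette (index x)

fiveColouring-lineFree : ∀ x y → ¬ MonochromaticLine fiveColouring x y
fiveColouring-lineFree = from-yes (∀-F₂^? λ x → ∀-F₂^? λ y → ¬? (monochromaticLine? fiveColouring x y))

corollary4p1 : χ₂≡ 7 5
corollary4p1 = ((λ x _ → fiveColouring x) , noMonochromaticLine⇒proper fiveColouring fiveColouring-lineFree)
             , fiveColoursNeeded
  where
  fiveColoursNeeded : ∀ m → Colourable 7 m → 5 ≤ m
  fiveColoursNeeded m colourable = ≮⇒≥ λ m<5 →
    from-no (2 ^ 7 ≤? ramseyBound 4)
      (≤-trans (colourable⇒2^n≤ramseyBound colourable) (ramseyBound-mono (≤-pred m<5)))
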